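{- Let $(U,\varphi)$ be a finite standard closure space with closed sets $\mathcal{C}$ and let $x\in U$. The family $\mathcal{G}_x=\{C\in\mathcal{C}: x \text{ is not prime in } (\downarrow C,\subseteq)\}$ is an up-set (filter) of $(\mathcal{C},\subseteq)$, and its inclusion-minimal members are exactly the closed sets $\varphi(A)$ with $A$ an $E$-generator of $x$: $\{\varphi(A): A \text{ an } E\text{ -generator of } x\}=\min_{\subseteq}\mathcal{G}_x$.
   Context: $(U,\varphi)$: finite set with closure operator; closed sets $\mathcal{C}$; standard: $\varphi(\{x\})\setminus\{x\}$ closed for all $x$. $\downarrow C=\{C'\in\mathcal{C}:C'\subseteq C\}$; $x$ is prime in $(\downarrow C,\subseteq)$ if for all $C_1,C_2\in\downarrow C$, $x\in\varphi(C_1\cup C_2)$ implies $x\in C_1$ or $x\in C_2$. $\varphi^b(X)=\bigcup_{y\in X}\varphi(\{y\})$. $D$-generator of $x$: $A$ with $x\in\varphi(A)$, $x\notin\varphi^b(A)$, and $x\notin\varphi(B)$ for all $B$ with $\varphi^b(B)\subsetneq\varphi^b(A)$. $E$-generator of $x$: a $D$-generator $A$ of $x$ with $\varphi(A)$ inclusion-minimal among closures of $D$-generators of $x$. -}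

module Defs where

open import Data.Nat using (ℕ)
open import Data.Bool using (if_then_else_)
open import Data.Fin using (Fin)
open import Data.Fin.Subset public
  using (Subset; ⁅_⁆; _∈_; _∉_; _⊆_; _⊂_; _∪_; _─_; ⋃; ⊥)
open import Data.Vec using (lookup)
open import Data.List using (map; allFin)
open import Data.Product using (_×_)
open import Data.Sum using (_⊎_)
open import Relation.Nullary using (¬_)
open import Relation.Binary.PropositionalEquality using (_≡_)

record ClosureOperator (n : ℕ) : Set where
  field
    φ          : Subset n → Subset n
    extensive  : ∀ X → X ⊆ φ X
    monotone   : ∀ {X Y} → X ⊆ Y → φ X ⊆ φ Y
    idempotent : ∀ X → φ (φ X) ≡ φ X

module _ {n : ℕ} (cl : ClosureOperator n) where
  open ClosureOperator cl

  Closed : Subset n → Set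
  Closed C = φ C ≡ C

  Standard : Set
  Standard = ∀ (x : Fin n) → Closed (φ ⁅ x ⁆ ─ ⁅ x ⁆)

  PrimeIn : Fin n → Subset n → Set
  PrimeIn x C = ∀ (C₁ C₂ : Subset n) → Closed C₁ → C₁ ⊆ C → Closed C₂ → C₂ ⊆ C →
                x ∈ φ (C₁ ∪ C₂) → x ∈ C₁ ⊎ x ∈ C₂

  𝒢 : Fin n → Subset n → Set
  𝒢 x C = Closed C × ¬ PrimeIn x C

  UpSetOfClosed : (Subset n → Set) → Set
  UpSetOfClosed F = ∀ (C C' : Subset n) → Closed C → Closed C' → C ⊆ C' → F C → F C'

  MinimalIn : (Subset n → Set) → Subset n → Set
  MinimalIn F C = F C × (∀ (C' : Subset n) → F C' → C' ⊆ C → C' ≡ C)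

  φᵇ : Subset n → Subset n
  φᵇ X = ⋃ (map (λ y → if lookup X y then φ ⁅ y ⁆ else ⊥) (allFin n))

  DGenerator : Fin n → Subset n → Set
  DGenerator x A = x ∈ φ A × x ∉ φᵇ A × (∀ (B : Subset n) → φᵇ B ⊂ φᵇ A → x ∉ φ B)

  EGenerator : Fin n → Subset n → Set
  EGenerator x A = DGenerator x A ×
    (∀ (A' : Subset n) → DGenerator x A' → φ A' ⊆ φ A → φ A' ≡ φ A)

-- A closed set C fails to be prime for x exactly when it contains closed sets C₁, C₂ with
-- x ∈ φ(C₁ ∪ C₂) but x ∉ C₁, C₂; such a splitting persists in larger closed sets, so 𝒢ₓ is
-- an up-set. Standardness makes a ↦ φ{a} antisymmetric, so deleting from a D-generator A an
-- element m with φ{m} maximal strictly shrinks φᵇ A; by D-minimality x ∉ φ(A ─ {m}), and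
-- φ{m}, φ(A ─ {m}) split φ(A). Conversely, inside a splitting C₁ ∪ C₂ a set generating x
-- with ⊂-minimal φᵇ is a D-generator. Hence the closures of D-generators form a coinitial
-- subfamily of 𝒢ₓ, the two families have the same minimal members, and the minimal closures
-- of D-generators are by definition the closures of E-generators.
{-# OPTIONS --safe #-}
module Submission where

open import Defs
open import Data.Nat using (ℕ)
open import Data.Bool using (true; false; if_then_else_)
open import Data.Bool.Properties using () renaming (_≟_ to _≟ᵇ_)
open import Data.Fin using (Fin)
open import Data.Fin.Properties using (_≟_; any?)
open import Data.Fin.Subset using (Nonempty; _⊃_; _-_; inside; outside)
open import Data.Fin.Subset.Properties
open import Data.Fin.Subset.Induction using (⊂-wellFounded; ⊃-wellFounded)
open import Data.List using (List; []; _∷_; map; allFin)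
open import Data.List.Relation.Unary.Any using (Any; here; there; satisfied)
open import Data.List.Relation.Unary.Any.Properties using (map⁺; map⁻)
open import Data.List.Membership.Propositional using (lose)
open import Data.List.Membership.Propositional.Properties using (∈-allFin)
open import Data.Vec using (lookup; _∷_; here; there)
open import Data.Vec.Properties using (≡-dec; []=⇒lookup; lookup⇒[]=)
open import Data.Product using (_×_; ∃; ∃₂; _,_; proj₂; map₂)
open import Data.Sum using (inj₁; inj₂; [_,_])
open import Function using (_∘_)
open import Function.Bundles using (_⇔_; mk⇔; Equivalence)
open import Function.Construct.Composition using (_⇔-∘_)
open import Function.Construct.Symmetry using (⇔-sym)
open import Induction.WellFounded using (WellFounded; Acc; acc)
open import Level using (0ℓ)
import Relation.Binary.Construct.On as On
open import Relation.Binary.Core using (Rel)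
open import Relation.Nullary using (¬_; Dec; yes; no; ¬?; contradiction)
open import Relation.Nullary.Decidable using (_×-dec_)
open import Relation.Binary.PropositionalEquality using (_≡_; _≢_; refl; sym; subst)

∃-minimal : ∀ {A : Set} {_≺_ : Rel A 0ℓ} {P : A → Set} → WellFounded _≺_ →
            (∀ a → Dec (∃ λ b → P b × b ≺ a)) →
            ∃ P → ∃ λ a → P a × (∀ b → P b → ¬ b ≺ a)
∃-minimal {_≺_ = _≺_} {P} wf smaller? (a , pa) = descend a (wf a) pa
  where
  descend : ∀ a → Acc _≺_ a → P a → ∃ λ a → P a × (∀ b → P b → ¬ b ≺ a)
  descend a (acc rs) pa with smaller? a
  ... | yes (b , pb , b≺a) = descend b (rs b≺a) pb
  ... | no none = a , pa , λ b pb b≺a → none (b , pb , b≺a)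

x∈p─q⇒x∉q : ∀ {n} {x : Fin n} (p q : Subset n) → x ∈ p ─ q → x ∉ q
x∈p─q⇒x∉q (inside  ∷ p) (outside ∷ q) here       ()
x∈p─q⇒x∉q (_       ∷ p) (_       ∷ q) (there x∈) (there x∈q) = x∈p─q⇒x∉q p q x∈ x∈q

⁅x⁆⊆p : ∀ {n} {x : Fin n} {p : Subset n} → x ∈ p → ⁅ x ⁆ ⊆ p
⁅x⁆⊆p {p = p} x∈p y∈⁅x⁆ = subst (_∈ p) (sym (x∈⁅y⁆⇒x≡y _ y∈⁅x⁆)) x∈p

x∈⋃⁻ : ∀ {n} {x : Fin n} (ps : List (Subset n)) → x ∈ ⋃ ps → Any (x ∈_) ps
x∈⋃⁻ []       x∈ = contradiction x∈ ∉⊥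
x∈⋃⁻ (p ∷ ps) x∈ with x∈p∪q⁻ p (⋃ ps) x∈
... | inj₁ x∈p    = here x∈p
... | inj₂ x∈⋃ps = there (x∈⋃⁻ ps x∈⋃ps)

x∈⋃⁺ : ∀ {n} {x : Fin n} {ps : List (Subset n)} → Any (x ∈_) ps → x ∈ ⋃ ps
x∈⋃⁺ (here x∈p)    = x∈p∪q⁺ (inj₁ x∈p)
x∈⋃⁺ (there x∈⋃ps) = x∈p∪q⁺ (inj₂ (x∈⋃⁺ x∈⋃ps))

module _ {n : ℕ} (cl : ClosureOperator n) where
  open ClosureOperator cl

  φ-least : ∀ {X K} → Closed cl K → X ⊆ K → φ X ⊆ K
  φ-least {X} K-closed X⊆K = subst (φ X ⊆_) K-closed (monotone X⊆K)

  φ⁅x⁆⊆closed : ∀ {x K} → Closed cl K → x ∈ K → φ ⁅ x ⁆ ⊆ K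
  φ⁅x⁆⊆closed K-closed x∈K = φ-least K-closed (⁅x⁆⊆p x∈K)

  closed? : ∀ C → Dec (Closed cl C)
  closed? C = ≡-dec _≟ᵇ_ (φ C) C

  φᵇ-summand : Subset n → Fin n → Subset n
  φᵇ-summand X z = if lookup X z then φ ⁅ z ⁆ else ⊥

  x∈φᵇ⁻ : ∀ {X y} → y ∈ φᵇ cl X → ∃ λ z → z ∈ X × y ∈ φ ⁅ z ⁆
  x∈φᵇ⁻ {X} {y} y∈ with satisfied (map⁻ (x∈⋃⁻ (map (φᵇ-summand X) (allFin n)) y∈))
  ... | z , y∈φz = z , member y∈φz
    where
    member : y ∈ φᵇ-summand X z → z ∈ X × y ∈ φ ⁅ z ⁆
    member y∈φz with lookup X z in eq
    ... | true  = lookup⇒[]= z X eq , y∈φz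
    ... | false = contradiction y∈φz ∉⊥

  x∈φᵇ⁺ : ∀ {X y z} → z ∈ X → y ∈ φ ⁅ z ⁆ → y ∈ φᵇ cl X
  x∈φᵇ⁺ {X} {y} {z} z∈X y∈φz = x∈⋃⁺ (map⁺ (lose (∈-allFin z) y∈φz′))
    where
    y∈φz′ : y ∈ φᵇ-summand X z
    y∈φz′ rewrite []=⇒lookup z∈X = y∈φz

  φᵇ-least : ∀ {X K} → (∀ {z} → z ∈ X → φ ⁅ z ⁆ ⊆ K) → φᵇ cl X ⊆ K
  φᵇ-least φz⊆K y∈ with x∈φᵇ⁻ y∈
  ... | z , z∈X , y∈φz = φz⊆K z∈X y∈φz

  φᵇ-mono : ∀ {X Y} → X ⊆ Y → φᵇ cl X ⊆ φᵇ cl Y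
  φᵇ-mono X⊆Y = φᵇ-least λ z∈X → x∈φᵇ⁺ (X⊆Y z∈X)

  p⊆φᵇp : ∀ {X} → X ⊆ φᵇ cl X
  p⊆φᵇp z∈X = x∈φᵇ⁺ z∈X (extensive _ (x∈⁅x⁆ _))

  φᵇ-∪-closed : ∀ {C₁ C₂} → Closed cl C₁ → Closed cl C₂ → φᵇ cl (C₁ ∪ C₂) ⊆ C₁ ∪ C₂
  φᵇ-∪-closed {C₁} {C₂} c₁ c₂ = φᵇ-least λ z∈ →
    [ (λ z∈C₁ → ⊆-trans (φ⁅x⁆⊆closed c₁ z∈C₁) (p⊆p∪q C₂))
    , (λ z∈C₂ → ⊆-trans (φ⁅x⁆⊆closed c₂ z∈C₂) (q⊆p∪q C₁ C₂))
    ] (x∈p∪q⁻ C₁ C₂ z∈)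

  Splits : Fin n → Subset n → Subset n → Subset n → Set
  Splits x C C₁ C₂ = Closed cl C₁ × C₁ ⊆ C × Closed cl C₂ × C₂ ⊆ C ×
                     x ∈ φ (C₁ ∪ C₂) × x ∉ C₁ × x ∉ C₂

  splits? : ∀ x C C₁ C₂ → Dec (Splits x C C₁ C₂)
  splits? x C C₁ C₂ = closed? C₁ ×-dec C₁ ⊆? C ×-dec closed? C₂ ×-dec C₂ ⊆? C ×-dec
                      x ∈? φ (C₁ ∪ C₂) ×-dec ¬? (x ∈? C₁) ×-dec ¬? (x ∈? C₂)

  Splits⇒¬PrimeIn : ∀ {x C C₁ C₂} → Splits x C C₁ C₂ → ¬ PrimeIn cl x C
  Splits⇒¬PrimeIn (c₁ , C₁⊆C , c₂ , C₂⊆C , x∈φ[C₁∪C₂] , x∉C₁ , x∉C₂) prime =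
    [ x∉C₁ , x∉C₂ ] (prime _ _ c₁ C₁⊆C c₂ C₂⊆C x∈φ[C₁∪C₂])

  -- Constructively, the splitting pair is found by exhaustive search over all pairs of subsets.
  ¬PrimeIn⇒Splits : ∀ {x C} → ¬ PrimeIn cl x C → ∃₂ (Splits x C)
  ¬PrimeIn⇒Splits {x} {C} not-prime with anySubset? (λ C₁ → anySubset? (λ C₂ → splits? x C C₁ C₂))
  ... | yes splitting   = splitting
  ... | no no-splitting = contradiction prime not-prime
    where
    prime : PrimeIn cl x C
    prime C₁ C₂ c₁ C₁⊆C c₂ C₂⊆C x∈φ[C₁∪C₂] with x ∈? C₁ | x ∈? C₂
    ... | yes x∈C₁ | _        = inj₁ x∈C₁
    ... | no  _    | yes x∈C₂ = inj₂ x∈C₂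
    ... | no  x∉C₁ | no  x∉C₂ =
      contradiction (C₁ , C₂ , c₁ , (λ {_} → C₁⊆C) , c₂ , (λ {_} → C₂⊆C) , x∈φ[C₁∪C₂] , x∉C₁ , x∉C₂)
                    no-splitting

  PrimeIn-antitone : ∀ {x C C′} → C ⊆ C′ → PrimeIn cl x C′ → PrimeIn cl x C
  PrimeIn-antitone C⊆C′ prime C₁ C₂ c₁ C₁⊆C c₂ C₂⊆C =
    prime C₁ C₂ c₁ (⊆-trans C₁⊆C C⊆C′) c₂ (⊆-trans C₂⊆C C⊆C′)

  𝒢-upSet : ∀ x → UpSetOfClosed cl (𝒢 cl x)
  𝒢-upSet x _ _ _ C′-closed C⊆C′ (_ , not-prime) = C′-closed , not-prime ∘ PrimeIn-antitone C⊆C′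

  DGeneratorClosure : Fin n → Subset n → Set
  DGeneratorClosure x C = ∃ λ A → DGenerator cl x A × φ A ≡ C

  DGenerator-within : ∀ {x S} → x ∈ φ S → x ∉ S → φᵇ cl S ⊆ S → ∃ λ A → DGenerator cl x A × A ⊆ S
  DGenerator-within {x} {S} x∈φS x∉S φᵇS⊆S
    with ∃-minimal (On.wellFounded (φᵇ cl) ⊂-wellFounded)
                   (λ A → anySubset? (λ B → (x ∈? φ B ×-dec B ⊆? S) ×-dec φᵇ cl B ⊂? φᵇ cl A))
                   (S , x∈φS , ⊆-refl)
  ... | A , (x∈φA , A⊆S) , A-minimal = A , (x∈φA , x∉S ∘ φᵇA⊆S , φᵇ-minimal) , A⊆S
    where
    φᵇA⊆S : φᵇ cl A ⊆ S
    φᵇA⊆S = ⊆-trans (φᵇ-mono A⊆S) φᵇS⊆S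
    φᵇ-minimal : ∀ B → φᵇ cl B ⊂ φᵇ cl A → x ∉ φ B
    φᵇ-minimal B φᵇB⊂φᵇA x∈φB =
      A-minimal B (x∈φB , ⊆-trans p⊆φᵇp (⊆-trans (p⊂q⇒p⊆q φᵇB⊂φᵇA) φᵇA⊆S)) φᵇB⊂φᵇA

  Splits⇒DGenerator-below : ∀ {x C C₁ C₂} → Closed cl C → Splits x C C₁ C₂ →
                            ∃ λ A → DGenerator cl x A × φ A ⊆ C
  Splits⇒DGenerator-below {C = C} {C₁} {C₂} C-closed (c₁ , C₁⊆C , c₂ , C₂⊆C , x∈φ[C₁∪C₂] , x∉C₁ , x∉C₂) =
    map₂ (map₂ λ A⊆C₁∪C₂ → φ-least C-closed λ a∈A → C₁∪C₂⊆C (A⊆C₁∪C₂ a∈A))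
         (DGenerator-within x∈φ[C₁∪C₂] ([ x∉C₁ , x∉C₂ ] ∘ x∈p∪q⁻ C₁ C₂) (φᵇ-∪-closed c₁ c₂))
    where
    C₁∪C₂⊆C : C₁ ∪ C₂ ⊆ C
    C₁∪C₂⊆C y∈ = [ C₁⊆C , C₂⊆C ] (x∈p∪q⁻ C₁ C₂ y∈)

  𝒢⇒DGeneratorClosure-below : ∀ {x C} → 𝒢 cl x C → ∃ λ D → DGeneratorClosure x D × D ⊆ C
  𝒢⇒DGeneratorClosure-below (C-closed , not-prime) =
    let A , dg , φA⊆C = Splits⇒DGenerator-below C-closed (proj₂ (proj₂ (¬PrimeIn⇒Splits not-prime)))
    in  φ A , (A , dg , refl) , φA⊆C

  φ⁅⁆-Maximal : Subset n → Fin n → Set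
  φ⁅⁆-Maximal A m = m ∈ A × (∀ a → a ∈ A → ¬ φ ⁅ a ⁆ ⊃ φ ⁅ m ⁆)

  ∃-φ⁅⁆-Maximal : ∀ {A} → Nonempty A → ∃ (φ⁅⁆-Maximal A)
  ∃-φ⁅⁆-Maximal {A} = ∃-minimal (On.wellFounded (λ a → φ ⁅ a ⁆) ⊃-wellFounded)
                                (λ m → any? λ a → (a ∈? A) ×-dec (φ ⁅ m ⁆ ⊂? φ ⁅ a ⁆))

  module _ (std : Standard cl) where

    x∉φ⊥ : ∀ x → x ∉ φ ⊥
    x∉φ⊥ x x∈φ⊥ = x∈p─q⇒x∉q (φ ⁅ x ⁆) ⁅ x ⁆ (φ-least (std x) ⊥⊆ x∈φ⊥) (x∈⁅x⁆ x)

    Nonempty-φ⁻ : ∀ {X} → Nonempty (φ X) → Nonempty X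
    Nonempty-φ⁻ {X} (x , x∈φX) with nonempty? X
    ... | yes X-nonempty = X-nonempty
    ... | no  X-empty    = contradiction (subst (λ Y → x ∈ φ Y) (Empty-unique X-empty) x∈φX) (x∉φ⊥ x)

    φ⁅⁆-antisym : ∀ {a b} → a ∈ φ ⁅ b ⁆ → b ∈ φ ⁅ a ⁆ → a ≡ b
    φ⁅⁆-antisym {a} {b} a∈φb b∈φa with a ≟ b
    ... | yes a≡b = a≡b
    ... | no  a≢b = contradiction (x∈⁅x⁆ b) (x∈p─q⇒x∉q (φ ⁅ b ⁆) ⁅ b ⁆ (φ⁅x⁆⊆closed (std b) a∈φb─b b∈φa))
      where
      a∈φb─b : a ∈ φ ⁅ b ⁆ ─ ⁅ b ⁆
      a∈φb─b = x∈p∧x≢y⇒x∈p-y a∈φb a≢b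

    φ⁅⁆-⊂ : ∀ {a b} → a ∈ φ ⁅ b ⁆ → a ≢ b → φ ⁅ a ⁆ ⊂ φ ⁅ b ⁆
    φ⁅⁆-⊂ {b = b} a∈φb a≢b =
      φ⁅x⁆⊆closed (idempotent _) a∈φb , b , extensive _ (x∈⁅x⁆ b) , a≢b ∘ φ⁅⁆-antisym a∈φb

    φᵇ-remove-maximal : ∀ {A m} → φ⁅⁆-Maximal A m → φᵇ cl (A - m) ⊂ φᵇ cl A
    φᵇ-remove-maximal {A} {m} (m∈A , m-maximal) =
      φᵇ-mono (p─q⊆p A ⁅ m ⁆) , m , p⊆φᵇp m∈A , m∉φᵇ[A-m]
      where
      m∉φᵇ[A-m] : m ∉ φᵇ cl (A - m)
      m∉φᵇ[A-m] m∈ with x∈φᵇ⁻ m∈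
      ... | a , a∈A-m , m∈φa = m-maximal a (p─q⊆p A ⁅ m ⁆ a∈A-m) (φ⁅⁆-⊂ m∈φa m≢a)
        where
        m≢a : m ≢ a
        m≢a = x∉⁅y⁆⇒x≢y (x∈p─q⇒x∉q A ⁅ m ⁆ a∈A-m) ∘ sym

    DGenerator-splits : ∀ {x A m} → DGenerator cl x A → φ⁅⁆-Maximal A m →
                        Splits x (φ A) (φ ⁅ m ⁆) (φ (A - m))
    DGenerator-splits {A = A} {m} (x∈φA , x∉φᵇA , φᵇ-minimal) m-max@(m∈A , _) =
      idempotent _ , monotone (⁅x⁆⊆p m∈A) , idempotent _ , monotone (p─q⊆p A ⁅ m ⁆) ,
      monotone A⊆ x∈φA , x∉φᵇA ∘ x∈φᵇ⁺ m∈A , φᵇ-minimal (A - m) (φᵇ-remove-maximal m-max)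
      where
      A⊆ : A ⊆ φ ⁅ m ⁆ ∪ φ (A - m)
      A⊆ {a} a∈A with a ≟ m
      ... | yes refl = x∈p∪q⁺ (inj₁ (extensive _ (x∈⁅x⁆ m)))
      ... | no  a≢m  = x∈p∪q⁺ (inj₂ (extensive _ (x∈p∧x≢y⇒x∈p-y a∈A a≢m)))

    DGeneratorClosure⇒𝒢 : ∀ {x C} → DGeneratorClosure x C → 𝒢 cl x C
    DGeneratorClosure⇒𝒢 {x} (A , dg@(x∈φA , _) , refl) =
      let _ , m-max = ∃-φ⁅⁆-Maximal (Nonempty-φ⁻ (x , x∈φA))
      in  idempotent A , Splits⇒¬PrimeIn (DGenerator-splits dg m-max)

  MinimalIn-coinitial : ∀ {F G : Subset n → Set} → (∀ {C} → G C → F C) →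
                        (∀ {C} → F C → ∃ λ D → G D × D ⊆ C) →
                        ∀ {C} → MinimalIn cl F C ⇔ MinimalIn cl G C
  MinimalIn-coinitial {F} {G} G⇒F F⇒G-below {C} = mk⇔ to from
    where
    to : MinimalIn cl F C → MinimalIn cl G C
    to (FC , F-minimal) =
      let D , GD , D⊆C = F⇒G-below FC
      in  subst G (F-minimal D (G⇒F GD) D⊆C) GD , λ C′ → F-minimal C′ ∘ G⇒F
    from : MinimalIn cl G C → MinimalIn cl F C
    from (GC , G-minimal) = G⇒F GC , F-minimal
      where
      F-minimal : ∀ C′ → F C′ → C′ ⊆ C → C′ ≡ C
      F-minimal C′ FC′ C′⊆C =
        let D , GD , D⊆C′ = F⇒G-below FC′
        in  ⊆-antisym C′⊆C (subst (_⊆ C′) (G-minimal D GD (⊆-trans D⊆C′ C′⊆C)) D⊆C′)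

  EGeneratorClosure⇔MinimalIn : ∀ {x C} →
    (∃ λ A → EGenerator cl x A × φ A ≡ C) ⇔ MinimalIn cl (DGeneratorClosure x) C
  EGeneratorClosure⇔MinimalIn {x} = mk⇔ to from
    where
    to : ∀ {C} → (∃ λ A → EGenerator cl x A × φ A ≡ C) → MinimalIn cl (DGeneratorClosure x) C
    to (A , (dg , φA-minimal) , refl) = (A , dg , refl) , λ { _ (A′ , dg′ , refl) → φA-minimal A′ dg′ }
    from : ∀ {C} → MinimalIn cl (DGeneratorClosure x) C → ∃ λ A → EGenerator cl x A × φ A ≡ C
    from ((A , dg , refl) , minimal) = A , (dg , λ A′ dg′ → minimal (φ A′) (A′ , dg′ , refl)) , refl

corollary1 : ∀ {n : ℕ} (cl : ClosureOperator n) → Standard cl → (x : Fin n) →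
    UpSetOfClosed cl (𝒢 cl x) ×
    (∀ (C : Subset n) →
      ((∃ λ A → EGenerator cl x A × ClosureOperator.φ cl A ≡ C) → MinimalIn cl (𝒢 cl x) C) ×
      (MinimalIn cl (𝒢 cl x) C → ∃ λ A → EGenerator cl x A × ClosureOperator.φ cl A ≡ C))
corollary1 cl std x = 𝒢-upSet cl x , λ C → Equivalence.from minimal⇔ , Equivalence.to minimal⇔
  where
  minimal⇔ : ∀ {C} → MinimalIn cl (𝒢 cl x) C ⇔ (∃ λ A → EGenerator cl x A × ClosureOperator.φ cl A ≡ C)
  minimal⇔ = ⇔-sym (EGeneratorClosure⇔MinimalIn cl)
         ⇔-∘ MinimalIn-coinitial cl (DGeneratorClosure⇒𝒢 cl std) (𝒢⇒DGeneratorClosure-below cl)
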